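{- Let $G=(V,E)$ be a graph and let ${\cal M}$ (source) and ${\cal M}'$ (target) be any two matchings of $G$. Then ${\cal M}$ can be gradually transformed into a matching containing ${\cal M}'$ (i.e., into ${\cal M}'$ or a superset of ${\cal M}'$) via a sequence of constant-time operations, grouped into phases of at most 3 operations each, such that the matching obtained at the end of each phase is a valid matching of $G$ of size at least $\min\{|{\cal M}|,|{\cal M}'|-1\}$. Moreover, the total running time of this transformation is $O(|{\cal M}|+|{\cal M}'|)$.
   Context: A gradual transformation maintains a current (transformed) set of edges ${\cal M}^*$, initialized to ${\cal M}$; an operation consists of a single edge insertion into or a single edge deletion from ${\cal M}^*$ and takes constant time. The transformation ends when the current set contains ${\cal M}'$. -}

module Defs where

open import Data.Nat using (ℕ; _+_; _∸_; _⊓_; _≤_)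
open import Data.Fin using (Fin)
open import Data.Fin.Subset using (Subset; _∈_; ∣_∣)
open import Data.Vec using (_[_]≔_)
open import Data.Bool using (true; false)
open import Data.List using (List; []; _∷_; foldl; length; map)
open import Data.Nat.ListAction using (sum)
open import Data.Product using (_×_; _,_; proj₁; proj₂)
open import Data.Sum using (_⊎_)
open import Relation.Nullary using (¬_)
open import Relation.Binary.PropositionalEquality using (_≡_; _≢_)

SameEnds : ∀ {n} → Fin n × Fin n → Fin n × Fin n → Set
SameEnds (a , b) (c , d) = (a ≡ c × b ≡ d) ⊎ (a ≡ d × b ≡ c)

Meet : ∀ {n} → Fin n × Fin n → Fin n × Fin n → Set
Meet (a , b) (c , d) = a ≡ c ⊎ a ≡ d ⊎ b ≡ c ⊎ b ≡ d

record Graph (n m : ℕ) : Set where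
  field
    ends     : Fin m → Fin n × Fin n
    loopless : ∀ e → proj₁ (ends e) ≢ proj₂ (ends e)
    simple   : ∀ e f → e ≢ f → ¬ SameEnds (ends e) (ends f)
open Graph public

IsMatching : ∀ {n m} → Graph n m → Subset m → Set
IsMatching G S = ∀ e f → e ∈ S → f ∈ S → e ≢ f → ¬ Meet (ends G e) (ends G f)

-- Constant-time operations on the current edge set M*.
data Op (m : ℕ) : Set where
  ins : Fin m → Op m
  del : Fin m → Op m

apply : ∀ {m} → Subset m → Op m → Subset m
apply S (ins e) = S [ e ]≔ true
apply S (del e) = S [ e ]≔ false

Phase : ℕ → Set
Phase m = List (Op m)

runPhase : ∀ {m} → Subset m → Phase m → Subset m
runPhase = foldl apply

trace : ∀ {m} → Subset m → List (Phase m) → List (Subset m)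
trace S []       = []
trace S (p ∷ ps) = runPhase S p ∷ trace (runPhase S p) ps

final : ∀ {m} → Subset m → List (Phase m) → Subset m
final S []       = S
final S (p ∷ ps) = final (runPhase S p) ps

totalOps : ∀ {m} → List (Phase m) → ℕ
totalOps ps = sum (map length ps)

module Submission where

-- While some edge f of M′ is missing from the current matching S, run the phase
-- "delete the edge of S at each endpoint of f, then insert f".  The result is again
-- a matching, it keeps every edge of M′ ∩ S and gains f, so at most |M′| phases of
-- three operations occur.  Sizes stay at least min(|M|, |M′| − 1): if some missing
-- edge has an endpoint free in S, its phase deletes at most one edge and the size
-- does not drop; otherwise a double counting of the meeting pairs (f, e) with
-- f ∈ M′ ─ S and e ∈ S ─ M′ shows |M′| ≤ |S|, and a phase loses at most one edge.

open import Defs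
open import Data.Nat using (ℕ; _+_; _*_; _∸_; _⊓_; _≤_)
open import Data.Fin.Subset using (Subset; _⊆_; ∣_∣)
open import Data.List using (List; length)
open import Data.List.Relation.Unary.All using (All)
open import Data.Product using (_×_; ∃-syntax)

open import Data.Nat using (zero; suc; z≤n; s≤s; NonZero)
open import Data.Nat.Properties
  using (+-*-semiring; ≤-refl; ≤-reflexive; ≤-trans; ≤-pred; n≤1+n; m≤m+n; m≤n+m;
         +-mono-≤; +-monoʳ-≤; +-suc; *-suc; *-zeroʳ; *-identityʳ; *-cancelˡ-≤; *-monoʳ-≤;
         ∸-monoˡ-≤; m⊓n≤m; m⊓n≤n; module ≤-Reasoning)
open import Algebra.Properties.Semiring.Sum +-*-semiring
  using (sum; sum-syntax; sum-cong-≗; sum-replicate-zero; ∑-distrib-+; ∑-comm; *-distribˡ-sum)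
open import Data.Fin using (Fin; _≟_)
open import Data.Fin.Properties using (any?; suc-injective)
open import Data.Fin.Subset using (_∈_; _∉_; _─_; _∩_; _⊂_; Nonempty)
open import Data.Fin.Subset.Properties
  using (_∈?_; nonempty?; drop-there; ∩-comm; x∈p∧x∉q⇒x∈p─q; ∣p─q∣≤∣p∣; p⊂q⇒∣p∣<∣q∣)
open import Data.Vec using ([]; _∷_; here; there; lookup; _[_]≔_)
open import Data.Vec.Properties using ([]=⇒lookup; lookup⇒[]=; lookup∘update′; []≔-updates; []≔-minimal; []≔-lookup)
open import Data.Bool using (true; false; if_then_else_)
open import Data.List using ([]; _∷_)
open import Data.List.Relation.Unary.All using ([]; _∷_)
open import Data.Product using (∃; _,_; proj₁; proj₂)
import Data.Product as Product
open import Data.Sum using (_⊎_; inj₁; inj₂; [_,_]′)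
open import Function using (_∘_)
open import Relation.Nullary using (¬_; Dec; yes; no; does; contradiction)
open import Relation.Nullary.Decidable using (_×-dec_; _⊎-dec_; ¬?)
open import Relation.Unary using (Decidable)
open import Relation.Binary.PropositionalEquality using (_≡_; _≢_; refl; sym; trans; cong; subst; subst₂)

𝟙 : ∀ {P : Set} → Dec P → ℕ
𝟙 d = if does d then 1 else 0

𝟙-yes : ∀ {P : Set} (d : Dec P) → P → 𝟙 d ≡ 1
𝟙-yes (yes _) _ = refl
𝟙-yes (no ¬p) p = contradiction p ¬p

𝟙-no : ∀ {P : Set} (d : Dec P) → ¬ P → 𝟙 d ≡ 0
𝟙-no (yes p) ¬p = contradiction p ¬p
𝟙-no (no _) _ = refl

𝟙-×-swap : ∀ {A B C : Set} (a : Dec A) (b : Dec B) (c : Dec C) →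
           𝟙 (a ×-dec (b ×-dec c)) ≡ 𝟙 (b ×-dec (a ×-dec c))
𝟙-×-swap (yes _) (yes _) c = refl
𝟙-×-swap (yes _) (no _)  c = refl
𝟙-×-swap (no _)  (yes _) c = refl
𝟙-×-swap (no _)  (no _)  c = refl

count : ∀ {k} {P : Fin k → Set} → Decidable P → ℕ
count {k} P? = ∑[ i < k ] 𝟙 (P? i)

∑-mono : ∀ {k} {f g : Fin k → ℕ} → (∀ i → f i ≤ g i) → sum f ≤ sum g
∑-mono {zero}  f≤g = z≤n
∑-mono {suc k} f≤g = +-mono-≤ (f≤g Fin.zero) (∑-mono (f≤g ∘ Fin.suc))

count-none : ∀ {k} {P : Fin k → Set} (P? : Decidable P) → (∀ i → ¬ P i) → count P? ≡ 0
count-none {k} P? none = trans (sum-cong-≗ (λ i → 𝟙-no (P? i) (none i))) (sum-replicate-zero k)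

count-≥1 : ∀ {k} {P : Fin k → Set} (P? : Decidable P) {i} → P i → 1 ≤ count P?
count-≥1 P? {Fin.zero}  p = ≤-trans (≤-reflexive (sym (𝟙-yes (P? Fin.zero) p))) (m≤m+n _ _)
count-≥1 P? {Fin.suc i} p = ≤-trans (count-≥1 (P? ∘ Fin.suc) p) (m≤n+m _ _)

count-≥2 : ∀ {k} {P : Fin k → Set} (P? : Decidable P) {i j} → i ≢ j → P i → P j → 2 ≤ count P?
count-≥2 P? {Fin.zero}  {Fin.zero}  i≢j p q = contradiction refl i≢j
count-≥2 P? {Fin.zero}  {Fin.suc j} i≢j p q =
  +-mono-≤ (≤-reflexive (sym (𝟙-yes (P? Fin.zero) p))) (count-≥1 (P? ∘ Fin.suc) q)
count-≥2 P? {Fin.suc i} {Fin.zero}  i≢j p q =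
  +-mono-≤ (≤-reflexive (sym (𝟙-yes (P? Fin.zero) q))) (count-≥1 (P? ∘ Fin.suc) p)
count-≥2 P? {Fin.suc i} {Fin.suc j} i≢j p q =
  ≤-trans (count-≥2 (P? ∘ Fin.suc) (i≢j ∘ cong Fin.suc) p q) (m≤n+m _ _)

count-≤1 : ∀ {k} {P : Fin k → Set} (P? : Decidable P) → (∀ i j → P i → P j → i ≡ j) → count P? ≤ 1
count-≤1 {zero}  P? unique = z≤n
count-≤1 {suc k} P? unique with P? Fin.zero
... | yes p = ≤-reflexive (cong suc (count-none (P? ∘ Fin.suc) (λ i q → contradiction (unique _ _ p q) λ ())))
... | no _  = count-≤1 (P? ∘ Fin.suc) (λ i j p q → suc-injective (unique _ _ p q))

count-⊎ : ∀ {k} {P Q R : Fin k → Set} (P? : Decidable P) (Q? : Decidable Q) (R? : Decidable R) →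
          (∀ i → P i → Q i ⊎ R i) → count P? ≤ count Q? + count R?
count-⊎ {k} P? Q? R? split =
  ≤-trans (∑-mono pointwise) (≤-reflexive (∑-distrib-+ (λ i → 𝟙 (Q? i)) (λ i → 𝟙 (R? i))))
  where
  pointwise : ∀ i → 𝟙 (P? i) ≤ 𝟙 (Q? i) + 𝟙 (R? i)
  pointwise i with P? i
  ... | no _  = z≤n
  ... | yes p with split i p
  ...   | inj₁ q = ≤-trans (≤-reflexive (sym (𝟙-yes (Q? i) q))) (m≤m+n _ _)
  ...   | inj₂ r = ≤-trans (≤-reflexive (sym (𝟙-yes (R? i) r))) (m≤n+m _ _)

-- If every selected left element has at least k selected R-neighbours and every
-- selected right element has at most k selected R-neighbours, then there are at
-- most as many selected left elements as selected right ones: both k·|P| and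
-- k·|Q| bound the number of R-related pairs, from below and above respectively.
double-counting : ∀ {a b} (k : ℕ) .{{_ : NonZero k}}
                  {P : Fin a → Set} {Q : Fin b → Set} {R : Fin a → Fin b → Set}
                  (P? : Decidable P) (Q? : Decidable Q) (R? : ∀ i j → Dec (R i j)) →
                  (∀ i → P i → k ≤ count (λ j → Q? j ×-dec R? i j)) →
                  (∀ j → Q j → count (λ i → P? i ×-dec R? i j) ≤ k) →
                  count P? ≤ count Q?
double-counting {a} {b} k P? Q? R? left right = *-cancelˡ-≤ k (begin
  k * count P?                                             ≡⟨ *-distribˡ-sum k (λ i → 𝟙 (P? i)) ⟩
  ∑[ i < a ] (k * 𝟙 (P? i))                                 ≤⟨ ∑-mono leftPairs ⟩
  ∑[ i < a ] ∑[ j < b ] 𝟙 (P? i ×-dec (Q? j ×-dec R? i j))  ≡⟨ ∑-comm (λ i j → 𝟙 (P? i ×-dec (Q? j ×-dec R? i j))) ⟩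
  ∑[ j < b ] ∑[ i < a ] 𝟙 (P? i ×-dec (Q? j ×-dec R? i j))  ≡⟨ sum-cong-≗ (λ j → sum-cong-≗ (λ i →
                                                                 𝟙-×-swap (P? i) (Q? j) (R? i j))) ⟩
  ∑[ j < b ] ∑[ i < a ] 𝟙 (Q? j ×-dec (P? i ×-dec R? i j))  ≤⟨ ∑-mono rightPairs ⟩
  ∑[ j < b ] (k * 𝟙 (Q? j))                                 ≡⟨ sym (*-distribˡ-sum k (λ j → 𝟙 (Q? j))) ⟩
  k * count Q?                                             ∎)
  where
  open ≤-Reasoning
  leftPairs : ∀ i → k * 𝟙 (P? i) ≤ ∑[ j < b ] 𝟙 (P? i ×-dec (Q? j ×-dec R? i j))
  leftPairs i with P? i
  ... | yes p = ≤-trans (≤-reflexive (*-identityʳ k)) (left i p)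
  ... | no _  = ≤-trans (≤-reflexive (*-zeroʳ k)) z≤n
  rightPairs : ∀ j → ∑[ i < a ] 𝟙 (Q? j ×-dec (P? i ×-dec R? i j)) ≤ k * 𝟙 (Q? j)
  rightPairs j with Q? j
  ... | yes q = ≤-trans (right j q) (≤-reflexive (sym (*-identityʳ k)))
  ... | no _  = ≤-trans (≤-reflexive (sum-replicate-zero a)) z≤n

∣p∣≡count : ∀ {k} (p : Subset k) → ∣ p ∣ ≡ count (_∈? p)
∣p∣≡count []          = refl
∣p∣≡count (true ∷ p)  = cong suc (∣p∣≡count p)
∣p∣≡count (false ∷ p) = ∣p∣≡count p

∣p∣≡∣p∩q∣+∣p─q∣ : ∀ {k} (p q : Subset k) → ∣ p ∣ ≡ ∣ p ∩ q ∣ + ∣ p ─ q ∣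
∣p∣≡∣p∩q∣+∣p─q∣ []          []          = refl
∣p∣≡∣p∩q∣+∣p─q∣ (true ∷ p)  (true ∷ q)  = cong suc (∣p∣≡∣p∩q∣+∣p─q∣ p q)
∣p∣≡∣p∩q∣+∣p─q∣ (true ∷ p)  (false ∷ q) = trans (cong suc (∣p∣≡∣p∩q∣+∣p─q∣ p q)) (sym (+-suc _ _))
∣p∣≡∣p∩q∣+∣p─q∣ (false ∷ p) (true ∷ q)  = ∣p∣≡∣p∩q∣+∣p─q∣ p q
∣p∣≡∣p∩q∣+∣p─q∣ (false ∷ p) (false ∷ q) = ∣p∣≡∣p∩q∣+∣p─q∣ p q

x∈p─q⁻ : ∀ {k} (p q : Subset k) {x} → x ∈ p ─ q → x ∈ p × x ∉ q
x∈p─q⁻ (true ∷ p)  (false ∷ q) here       = here , λ ()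
x∈p─q⁻ (true ∷ p)  (true ∷ q)  {Fin.zero} ()
x∈p─q⁻ (false ∷ p) (true ∷ q)  {Fin.zero} ()
x∈p─q⁻ (false ∷ p) (false ∷ q) {Fin.zero} ()
x∈p─q⁻ (_ ∷ p)     (_ ∷ q)     (there x∈) = Product.map there (λ x∉q → x∉q ∘ drop-there) (x∈p─q⁻ p q x∈)

∈-update⁻ : ∀ {k} (T : Subset k) {x e β} → x ≢ e → x ∈ T [ e ]≔ β → x ∈ T
∈-update⁻ T {x} {e} {β} x≢e x∈ = lookup⇒[]= x T (trans (sym (lookup∘update′ x≢e T β)) ([]=⇒lookup x∈))

∉-delete : ∀ {k} (T : Subset k) e → e ∉ T [ e ]≔ false
∉-delete T e e∈ with () ← trans (sym ([]=⇒lookup e∈)) ([]=⇒lookup ([]≔-updates T e))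

∈-delete⁻ : ∀ {k} (T : Subset k) {x e} → x ∈ T [ e ]≔ false → x ∈ T × x ≢ e
∈-delete⁻ T {x} {e} x∈ with x ≟ e
... | yes refl = contradiction x∈ (∉-delete T e)
... | no x≢e   = ∈-update⁻ T x≢e x∈ , x≢e

delete-∉ : ∀ {k} (T : Subset k) {e} → e ∉ T → T [ e ]≔ false ≡ T
delete-∉ T {e} e∉ with lookup T e in eq
... | true  = contradiction (lookup⇒[]= e T eq) e∉
... | false = trans (cong (T [ e ]≔_) (sym eq)) ([]≔-lookup T e)

∣insert∣ : ∀ {k} (T : Subset k) {e} → e ∉ T → ∣ T [ e ]≔ true ∣ ≡ suc ∣ T ∣
∣insert∣ (true ∷ T)  {Fin.zero}  e∉ = contradiction here e∉
∣insert∣ (false ∷ T) {Fin.zero}  e∉ = refl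
∣insert∣ (true ∷ T)  {Fin.suc e} e∉ = cong suc (∣insert∣ T (e∉ ∘ there))
∣insert∣ (false ∷ T) {Fin.suc e} e∉ = ∣insert∣ T (e∉ ∘ there)

∣delete∣ : ∀ {k} (T : Subset k) e → ∣ T ∣ ≤ suc ∣ T [ e ]≔ false ∣
∣delete∣ (true ∷ T)  Fin.zero    = ≤-refl
∣delete∣ (false ∷ T) Fin.zero    = n≤1+n _
∣delete∣ (true ∷ T)  (Fin.suc e) = s≤s (∣delete∣ T e)
∣delete∣ (false ∷ T) (Fin.suc e) = ∣delete∣ T e

module Matchings {n m : ℕ} (G : Graph n m) where

  u v : Fin m → Fin n
  u e = proj₁ (ends G e)
  v e = proj₂ (ends G e)

  Touches : Fin m → Fin n → Set
  Touches e w = u e ≡ w ⊎ v e ≡ w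

  touches? : ∀ e w → Dec (Touches e w)
  touches? e w = (u e ≟ w) ⊎-dec (v e ≟ w)

  meet? : ∀ e f → Dec (Meet (ends G e) (ends G f))
  meet? e f = (u e ≟ u f) ⊎-dec ((u e ≟ v f) ⊎-dec ((v e ≟ u f) ⊎-dec (v e ≟ v f)))

  meet⇒common : ∀ {e f} → Meet (ends G e) (ends G f) → ∃ λ w → Touches e w × Touches f w
  meet⇒common (inj₁ p)                 = _ , inj₁ p , inj₁ refl
  meet⇒common (inj₂ (inj₁ p))          = _ , inj₁ p , inj₂ refl
  meet⇒common (inj₂ (inj₂ (inj₁ p)))   = _ , inj₂ p , inj₁ refl
  meet⇒common (inj₂ (inj₂ (inj₂ p)))   = _ , inj₂ p , inj₂ refl

  common⇒meet : ∀ {e f w} → Touches e w → Touches f w → Meet (ends G e) (ends G f)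
  common⇒meet (inj₁ p) (inj₁ q) = inj₁ (trans p (sym q))
  common⇒meet (inj₁ p) (inj₂ q) = inj₂ (inj₁ (trans p (sym q)))
  common⇒meet (inj₂ p) (inj₁ q) = inj₂ (inj₂ (inj₁ (trans p (sym q))))
  common⇒meet (inj₂ p) (inj₂ q) = inj₂ (inj₂ (inj₂ (trans p (sym q))))

  touches-both-ends : ∀ {e f} → Touches e (u f) → Touches e (v f) → e ≡ f
  touches-both-ends {e} {f} te₁ te₂ with e ≟ f
  ... | yes e≡f = e≡f
  ... | no  e≢f = contradiction (te₁ , te₂) (same-ends e≢f)
    where
    same-ends : e ≢ f → ¬ (Touches e (u f) × Touches e (v f))
    same-ends e≢f (inj₁ p , inj₁ q) = loopless G f (trans (sym p) q)
    same-ends e≢f (inj₁ p , inj₂ q) = simple G e f e≢f (inj₁ (p , q))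
    same-ends e≢f (inj₂ p , inj₁ q) = simple G e f e≢f (inj₂ (q , p))
    same-ends e≢f (inj₂ p , inj₂ q) = loopless G f (trans (sym p) q)

  matching-unique : ∀ {S e f w} → IsMatching G S → e ∈ S → f ∈ S → Touches e w → Touches f w → e ≡ f
  matching-unique {e = e} {f} hS e∈ f∈ te tf with e ≟ f
  ... | yes e≡f = e≡f
  ... | no  e≢f = contradiction (common⇒meet te tf) (hS e f e∈ f∈ e≢f)

  matching-⊆ : ∀ {S T} → T ⊆ S → IsMatching G S → IsMatching G T
  matching-⊆ T⊆S hS e f e∈ f∈ = hS e f (T⊆S e∈) (T⊆S f∈)

  matching-insert : ∀ {T f} → IsMatching G T → (∀ {e w} → e ∈ T → Touches f w → ¬ Touches e w) →
                    IsMatching G (T [ f ]≔ true)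
  matching-insert {T} {f} hT free x y x∈ y∈ x≢y x⋈y with meet⇒common x⋈y | x ≟ f | y ≟ f
  ... | _ , tx , ty | yes refl | yes refl = x≢y refl
  ... | _ , tx , ty | yes refl | no  y≢f  = free (∈-update⁻ T y≢f y∈) tx ty
  ... | _ , tx , ty | no  x≢f  | yes refl = free (∈-update⁻ T x≢f x∈) ty tx
  ... | _ , tx , ty | no  x≢f  | no  y≢f  = hT x y (∈-update⁻ T x≢f x∈) (∈-update⁻ T y≢f y∈) x≢y x⋈y

  Covered : Subset m → Fin n → Set
  Covered S w = ∃ λ e → e ∈ S × Touches e w

  covered? : ∀ S w → Dec (Covered S w)
  covered? S w = any? (λ e → (e ∈? S) ×-dec touches? e w)

  coverOr : Subset m → Fin n → Fin m → Fin m
  coverOr S w d with covered? S w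
  ... | yes (e , _) = e
  ... | no  _       = d

  coverOr-touches : ∀ {S w d} → Touches d w → Touches (coverOr S w d) w
  coverOr-touches {S} {w} td with covered? S w
  ... | yes (_ , _ , te) = te
  ... | no  _            = td

  coverOr-unique : ∀ {S w d e} → IsMatching G S → e ∈ S → Touches e w → e ≡ coverOr S w d
  coverOr-unique {S} {w} hS e∈ te with covered? S w
  ... | yes (_ , c∈ , tc) = matching-unique hS e∈ c∈ te tc
  ... | no  uncovered     = contradiction (_ , e∈ , te) uncovered

  coverOr-free : ∀ {S w d} → ¬ Covered S w → coverOr S w d ≡ d
  coverOr-free {S} {w} uncovered with covered? S w
  ... | yes c = contradiction c uncovered
  ... | no  _ = refl

  -- An endpoint that is free in S has default f, whose
  -- deletion is a no-op because f ∉ S.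
  phase : Subset m → Fin m → Phase m
  phase S f = del (coverOr S (u f) f) ∷ del (coverOr S (v f) f) ∷ ins f ∷ []

  module Phase {S : Subset m} (hS : IsMatching G S) {f : Fin m} (f∉S : f ∉ S) where

    a b : Fin m
    a = coverOr S (u f) f
    b = coverOr S (v f) f

    S₁ S₂ S₃ : Subset m
    S₁ = S [ a ]≔ false
    S₂ = S₁ [ b ]≔ false
    S₃ = S₂ [ f ]≔ true

    S₂⊆S : S₂ ⊆ S
    S₂⊆S x∈ = proj₁ (∈-delete⁻ S (proj₁ (∈-delete⁻ S₁ x∈)))

    f-free : ∀ {e w} → e ∈ S₂ → Touches f w → ¬ Touches e w
    f-free e∈ (inj₁ refl) te = proj₂ (∈-delete⁻ S (proj₁ (∈-delete⁻ S₁ e∈))) (coverOr-unique hS (S₂⊆S e∈) te)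
    f-free e∈ (inj₂ refl) te = proj₂ (∈-delete⁻ S₁ e∈) (coverOr-unique hS (S₂⊆S e∈) te)

    phase-matching : IsMatching G S₃
    phase-matching = matching-insert (matching-⊆ S₂⊆S hS) f-free

    phase-keeps : ∀ {M′ x} → IsMatching G M′ → f ∈ M′ → x ∈ M′ → x ∈ S → x ∈ S₃
    phase-keeps {x = x} hM′ f∈M′ x∈M′ x∈S =
      []≔-minimal S₂ _ f x≢f ([]≔-minimal S₁ _ b (avoids (inj₂ refl)) ([]≔-minimal S _ a (avoids (inj₁ refl)) x∈S))
      where
      x≢f : x ≢ f
      x≢f refl = f∉S x∈S
      avoids : ∀ {w} → Touches f w → x ≢ coverOr S w f
      avoids tf refl = x≢f (matching-unique hM′ x∈M′ f∈M′ (coverOr-touches tf) tf)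

    phase-progress : ∀ {M′} → IsMatching G M′ → f ∈ M′ → M′ ─ S₃ ⊂ M′ ─ S
    phase-progress {M′} hM′ f∈M′ = shrinks , f , x∈p∧x∉q⇒x∈p─q f∈M′ f∉S , λ f∈ → proj₂ (x∈p─q⁻ M′ S₃ f∈) f∈S₃
      where
      f∈S₃ : f ∈ S₃
      f∈S₃ = []≔-updates S₂ f
      shrinks : M′ ─ S₃ ⊆ M′ ─ S
      shrinks x∈ with x∈p─q⁻ M′ S₃ x∈
      ... | x∈M′ , x∉S₃ = x∈p∧x∉q⇒x∈p─q x∈M′ (x∉S₃ ∘ phase-keeps hM′ f∈M′ x∈M′)

    ∣S₃∣≡1+∣S₂∣ : ∣ S₃ ∣ ≡ suc ∣ S₂ ∣
    ∣S₃∣≡1+∣S₂∣ = ∣insert∣ S₂ (f∉S ∘ S₂⊆S)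

    phase-size : ∣ S ∣ ≤ suc ∣ S₃ ∣
    phase-size = begin
      ∣ S ∣              ≤⟨ ∣delete∣ S a ⟩
      suc ∣ S₁ ∣         ≤⟨ s≤s (∣delete∣ S₁ b) ⟩
      suc (suc ∣ S₂ ∣)   ≡⟨ cong suc (sym ∣S₃∣≡1+∣S₂∣) ⟩
      suc ∣ S₃ ∣         ∎
      where open ≤-Reasoning

    phase-size-u-free : ¬ Covered S (u f) → ∣ S ∣ ≤ ∣ S₃ ∣
    phase-size-u-free u-free = begin
      ∣ S ∣        ≡⟨ cong ∣_∣ (sym S₁≡S) ⟩
      ∣ S₁ ∣       ≤⟨ ∣delete∣ S₁ b ⟩
      suc ∣ S₂ ∣   ≡⟨ sym ∣S₃∣≡1+∣S₂∣ ⟩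
      ∣ S₃ ∣       ∎
      where
      open ≤-Reasoning
      S₁≡S : S₁ ≡ S
      S₁≡S = trans (cong (λ e → S [ e ]≔ false) (coverOr-free u-free)) (delete-∉ S f∉S)

    phase-size-v-free : ¬ Covered S (v f) → ∣ S ∣ ≤ ∣ S₃ ∣
    phase-size-v-free v-free = begin
      ∣ S ∣        ≤⟨ ∣delete∣ S a ⟩
      suc ∣ S₁ ∣   ≡⟨ cong (suc ∘ ∣_∣) (sym S₂≡S₁) ⟩
      suc ∣ S₂ ∣   ≡⟨ sym ∣S₃∣≡1+∣S₂∣ ⟩
      ∣ S₃ ∣       ∎
      where
      open ≤-Reasoning
      S₂≡S₁ : S₂ ≡ S₁
      S₂≡S₁ = trans (cong (λ e → S₁ [ e ]≔ false) (coverOr-free v-free))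
                    (delete-∉ S₁ (f∉S ∘ proj₁ ∘ ∈-delete⁻ S))

    phase-size-free : ¬ (Covered S (u f) × Covered S (v f)) → ∣ S ∣ ≤ ∣ S₃ ∣
    phase-size-free not-both = [ phase-size-u-free , phase-size-v-free ]′ (one-free (covered? S (u f)))
      where
      one-free : Dec (Covered S (u f)) → ¬ Covered S (u f) ⊎ ¬ Covered S (v f)
      one-free (yes u-covered) = inj₂ (λ v-covered → not-both (u-covered , v-covered))
      one-free (no  u-free)    = inj₁ u-free

  -- If every edge of M′ missing from S has both endpoints covered
  -- by S, then |M′| ≤ |S|: each missing edge meets two distinct edges of S ─ M′
  -- (one per endpoint), while each edge meets at most two edges of the matching M′.
  saturated⇒≤ : ∀ {S M′} → IsMatching G M′ →
                (∀ {f} → f ∈ M′ ─ S → Covered S (u f) × Covered S (v f)) → ∣ M′ ∣ ≤ ∣ S ∣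
  saturated⇒≤ {S} {M′} hM′ saturated = begin
    ∣ M′ ∣                   ≡⟨ ∣p∣≡∣p∩q∣+∣p─q∣ M′ S ⟩
    ∣ M′ ∩ S ∣ + ∣ M′ ─ S ∣  ≤⟨ +-monoʳ-≤ ∣ M′ ∩ S ∣ missing≤surplus ⟩
    ∣ M′ ∩ S ∣ + ∣ S ─ M′ ∣  ≡⟨ cong (λ T → ∣ T ∣ + ∣ S ─ M′ ∣) (∩-comm M′ S) ⟩
    ∣ S ∩ M′ ∣ + ∣ S ─ M′ ∣  ≡⟨ sym (∣p∣≡∣p∩q∣+∣p─q∣ S M′) ⟩
    ∣ S ∣                    ∎
    where
    open ≤-Reasoning

    two-surplus : ∀ f → f ∈ M′ ─ S → 2 ≤ count (λ e → (e ∈? S ─ M′) ×-dec meet? f e)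
    two-surplus f f∈ with x∈p─q⁻ M′ S f∈ | saturated f∈
    ... | f∈M′ , f∉S | (eu , eu∈S , teu) , (ev , ev∈S , tev) =
      count-≥2 (λ e → (e ∈? S ─ M′) ×-dec meet? f e) eu≢ev (surplus eu∈S teu (inj₁ refl)) (surplus ev∈S tev (inj₂ refl))
      where
      surplus : ∀ {e w} → e ∈ S → Touches e w → Touches f w → e ∈ S ─ M′ × Meet (ends G f) (ends G e)
      surplus e∈S te tf =
        x∈p∧x∉q⇒x∈p─q e∈S (λ e∈M′ → f∉S (subst (_∈ S) (matching-unique hM′ e∈M′ f∈M′ te tf) e∈S)) ,
        common⇒meet tf te
      eu≢ev : eu ≢ ev
      eu≢ev refl = f∉S (subst (_∈ S) (touches-both-ends teu tev) eu∈S)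

    at-most-two : ∀ e → e ∈ S ─ M′ → count (λ f → (f ∈? M′ ─ S) ×-dec meet? f e) ≤ 2
    at-most-two e _ = ≤-trans (count-⊎ (λ f → (f ∈? M′ ─ S) ×-dec meet? f e) (at? (u e)) (at? (v e)) at-an-end) (+-mono-≤ (one-at (u e)) (one-at (v e)))
      where
      At : Fin n → Fin m → Set
      At w f = f ∈ M′ × Touches f w
      at? : ∀ w → Decidable (At w)
      at? w f = (f ∈? M′) ×-dec touches? f w
      one-at : ∀ w → count (at? w) ≤ 1
      one-at w = count-≤1 (at? w) (λ i j (i∈ , ti) (j∈ , tj) → matching-unique hM′ i∈ j∈ ti tj)
      at-an-end : ∀ f → f ∈ M′ ─ S × Meet (ends G f) (ends G e) → At (u e) f ⊎ At (v e) f
      at-an-end f (f∈ , f⋈e) with meet⇒common f⋈e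
      ... | _ , tf , inj₁ refl = inj₁ (proj₁ (x∈p─q⁻ M′ S f∈) , tf)
      ... | _ , tf , inj₂ refl = inj₂ (proj₁ (x∈p─q⁻ M′ S f∈) , tf)

    missing≤surplus : ∣ M′ ─ S ∣ ≤ ∣ S ─ M′ ∣
    missing≤surplus = subst₂ _≤_ (sym (∣p∣≡count (M′ ─ S))) (sym (∣p∣≡count (S ─ M′)))
      (double-counting 2 (λ f → f ∈? M′ ─ S) (λ e → e ∈? S ─ M′) meet? two-surplus at-most-two)

  module Transform {M′ : Subset m} (hM′ : IsMatching G M′) (L : ℕ) (L≤M′ : L ≤ ∣ M′ ∣ ∸ 1) where

    Transformation : Subset m → ℕ → Set
    Transformation S k = ∃[ ps ] (All (λ p → length p ≤ 3) ps
                          × All (λ T → IsMatching G T × L ≤ ∣ T ∣) (trace S ps)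
                          × M′ ⊆ final S ps
                          × totalOps ps ≤ 3 * k)

    finished : ∀ {S} k → M′ ⊆ S → Transformation S k
    finished k M′⊆S = [] , [] , [] , M′⊆S , z≤n

    nothing-missing : ∀ {S} → (∀ {x} → x ∉ M′ ─ S) → M′ ⊆ S
    nothing-missing {S} none {x} x∈M′ with x ∈? S
    ... | yes x∈S = x∈S
    ... | no  x∉S = contradiction (x∈p∧x∉q⇒x∈p─q x∈M′ x∉S) none

    prepend : ∀ {S k f} (hS : IsMatching G S) (f∉S : f ∉ S) → L ≤ ∣ runPhase S (phase S f) ∣ →
              Transformation (runPhase S (phase S f)) k → Transformation S (suc k)
    prepend {S} {k} {f} hS f∉S L≤S₃ (ps , short , valid , covers , ops) =
      phase S f ∷ ps , ≤-refl ∷ short , (Phase.phase-matching hS f∉S , L≤S₃) ∷ valid , covers ,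
      subst (3 + totalOps ps ≤_) (sym (*-suc 3 k)) (+-monoʳ-≤ 3 ops)

    -- Some missing edge yields a phase ending at size at least L: one with a free
    -- endpoint loses nothing; if there is none, the counting lemma gives |M′| ≤ |S|,
    -- and any phase loses at most one edge.
    good-phase : ∀ {S} → IsMatching G S → L ≤ ∣ S ∣ → Nonempty (M′ ─ S) →
                 ∃[ f ] (f ∈ M′ ─ S × L ≤ ∣ runPhase S (phase S f) ∣)
    good-phase {S} hS L≤S (g , g∈)
      with any? (λ f → (f ∈? M′ ─ S) ×-dec ¬? (covered? S (u f) ×-dec covered? S (v f)))
    ... | yes (f , f∈ , not-both) = f , f∈ , ≤-trans L≤S (Phase.phase-size-free hS (proj₂ (x∈p─q⁻ M′ S f∈)) not-both)
    ... | no  none                = g , g∈ , (begin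
      L                                 ≤⟨ L≤M′ ⟩
      ∣ M′ ∣ ∸ 1                        ≤⟨ ∸-monoˡ-≤ 1 (≤-trans (saturated⇒≤ hM′ saturated) (Phase.phase-size hS g∉S)) ⟩
      ∣ runPhase S (phase S g) ∣        ∎)
      where
      open ≤-Reasoning
      g∉S : g ∉ S
      g∉S = proj₂ (x∈p─q⁻ M′ S g∈)
      saturated : ∀ {f} → f ∈ M′ ─ S → Covered S (u f) × Covered S (v f)
      saturated {f} f∈ with covered? S (u f) ×-dec covered? S (v f)
      ... | yes both     = both
      ... | no  not-both = contradiction (f , f∈ , not-both) none

    transform : ∀ k {S} → IsMatching G S → L ≤ ∣ S ∣ → ∣ M′ ─ S ∣ ≤ k → Transformation S k
    transform zero {S} hS L≤S μ≤0 =
      finished zero (nothing-missing (λ x∈ → contradiction (≤-trans (member⇒1≤∣p∣ x∈) μ≤0) λ ()))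
      where
      member⇒1≤∣p∣ : ∀ {p : Subset m} {x} → x ∈ p → 1 ≤ ∣ p ∣
      member⇒1≤∣p∣ {p} x∈ = ≤-trans (count-≥1 (_∈? p) x∈) (≤-reflexive (sym (∣p∣≡count p)))
    transform (suc k) {S} hS L≤S μ≤k with nonempty? (M′ ─ S)
    ... | no  none    = finished (suc k) (nothing-missing (λ x∈ → none (_ , x∈)))
    ... | yes missing with good-phase hS L≤S missing
    ...   | f , f∈ , L≤S₃ = prepend hS f∉S L≤S₃ (transform k (Phase.phase-matching hS f∉S) L≤S₃ μ′≤k)
      where
      f∉S : f ∉ S
      f∉S = proj₂ (x∈p─q⁻ M′ S f∈)
      μ′≤k : ∣ M′ ─ runPhase S (phase S f) ∣ ≤ k
      μ′≤k = ≤-pred (≤-trans (p⊂q⇒∣p∣<∣q∣ (Phase.phase-progress hS f∉S hM′ (proj₁ (x∈p─q⁻ M′ S f∈)))) μ≤k)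

theorem1 : ∃[ c ] (∀ {n m} (G : Graph n m) (M M′ : Subset m) →
             IsMatching G M → IsMatching G M′ →
             ∃[ ps ] (All (λ p → length p ≤ 3) ps
               × All (λ S → IsMatching G S × ∣ M ∣ ⊓ (∣ M′ ∣ ∸ 1) ≤ ∣ S ∣) (trace M ps)
               × M′ ⊆ final M ps
               × totalOps ps ≤ c * (∣ M ∣ + ∣ M′ ∣)))
theorem1 = 3 , λ G M M′ hM hM′ →
  let open Matchings G
      open Transform hM′ (∣ M ∣ ⊓ (∣ M′ ∣ ∸ 1)) (m⊓n≤n _ _)
      ps , short , valid , covers , ops = transform ∣ M′ ∣ hM (m⊓n≤m _ _) (∣p─q∣≤∣p∣ M′ M)
  in ps , short , valid , covers , ≤-trans ops (*-monoʳ-≤ 3 (m≤n+m ∣ M′ ∣ ∣ M ∣))
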